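{- For every integer $k \geq 1$, let $\mathcal{B}(k)$ denote the greatest common divisor of all the integers $\sum_{i=1}^{k} B_{n+i}$ for $n \geq 0$. Then $$\mathcal{B}(k) = \begin{cases} \tfrac{1}{2}P_{k}, & \text{if } k \text{ is even};\\ Q_{k}, & \text{if } k \text{ is odd}.\end{cases}$$
   Context: The balancing sequence $(B_n)_{n\ge 0}$ is defined by $B_0=0$, $B_1=1$, $B_n=6B_{n-1}-B_{n-2}$ for $n\ge 2$. The Pell sequence $(P_n)_{n\ge 0}$ is defined by $P_0=0$, $P_1=1$, $P_n=2P_{n-1}+P_{n-2}$; the associated Pell sequence $(Q_n)_{n\ge 0}$ by $Q_0=1$, $Q_1=1$, $Q_n=2Q_{n-1}+Q_{n-2}$. -}

module Defs where

open import Data.Nat using (ℕ; zero; suc; _+_; _*_; _∸_)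
open import Data.Nat.Divisibility using (_∣_)
open import Data.Product using (_×_)

-- balancing numbers: B 0 = 0, B 1 = 1, B (n+2) = 6 B (n+1) - B n  (always ≥ 0)
B : ℕ → ℕ
B zero = 0
B (suc zero) = 1
B (suc (suc n)) = 6 * B (suc n) ∸ B n

P : ℕ → ℕ
P zero = 0
P (suc zero) = 1
P (suc (suc n)) = 2 * P (suc n) + P n

Q : ℕ → ℕ
Q zero = 1
Q (suc zero) = 1
Q (suc (suc n)) = 2 * Q (suc n) + Q n

sumB : ℕ → ℕ → ℕ
sumB zero n = 0
sumB (suc k) n = sumB k n + B (n + suc k)

IsGCDOf : (ℕ → ℕ) → ℕ → Set
IsGCDOf f d = (∀ n → d ∣ f n) × (∀ c → (∀ n → c ∣ f n) → c ∣ d)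

-- Since 2 B j = P (2 j), the sum telescopes: 4 Σ_{i=1}^{k} B (n + i) = P (2 (n + k) + 1) − P (2 n + 1).
-- The Pell norm equation Q k ^ 2 − 2 P k ^ 2 = (−1) ^ k factors this difference, giving
--   Σ = B (k / 2) · Q (2 (n + k / 2) + 1)   for k even,   Σ = Q k · B (n + (k + 1) / 2)   for k odd.
-- In both cases the cofactor runs, as n varies, through a sequence x with x (m + 2) + x m = 6 x (m + 1)
-- and first term 1; two consecutive terms of such a sequence have no common divisor but 1, so the gcd
-- is the fixed factor.
module Submission where

open import Defs
open import Data.Nat using (ℕ; _≤_; _/_; zero; suc; _+_; _*_; _∸_; NonZero)
open import Data.Nat.Divisibility
  using (_∣_; divides; ∣-refl; _∣0; ∣m∣n⇒∣m+n; ∣m+n∣m⇒∣n; m∣m*n; ∣n⇒∣m*n)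
open import Data.Nat.DivMod using (m*n/n≡m)
open import Data.Nat.Properties
  using (+-comm; +-suc; +-identityʳ; +-cancelʳ-≡; *-cancelˡ-≡; *-comm; *-identityʳ; *-distribˡ-+; *-distribˡ-∸;
         m+n∸n≡m; *-commutativeSemigroup)
open import Algebra.Properties.CommutativeSemigroup *-commutativeSemigroup using (x∙yz≈y∙xz)
open import Data.Nat.Tactic.RingSolver using (solve-∀)
open import Data.Product using (_×_; _,_; proj₁; proj₂; ∃-syntax)
open import Data.Empty using (⊥-elim)
open import Relation.Nullary using (¬_)
open import Relation.Binary.PropositionalEquality

PellRecurrence : (ℕ → ℕ) → Set
PellRecurrence u = ∀ n → u (suc (suc n)) ≡ 2 * u (suc n) + u n

-- u (n + 2) = 6 u (n + 1) − u n, stated without truncated subtraction.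
BalancingRecurrence : (ℕ → ℕ) → Set
BalancingRecurrence u = ∀ n → u (suc (suc n)) + u n ≡ 6 * u (suc n)

pell⇒balancing-evens : ∀ {u} → PellRecurrence u → BalancingRecurrence (λ j → u (j * 2))
pell⇒balancing-evens {u} rec j
  rewrite rec (suc (suc (j * 2))) | rec (suc (j * 2)) | rec (j * 2) =
  identity (u (suc (j * 2))) (u (j * 2))
  where
  identity : ∀ a b → 2 * (2 * (2 * a + b) + a) + (2 * a + b) + b ≡ 6 * (2 * a + b)
  identity = solve-∀

balancing-∸ : ∀ {u} → BalancingRecurrence u → ∀ n → u (suc (suc n)) ≡ 6 * u (suc n) ∸ u n
balancing-∸ {u} rec n = trans (sym (m+n∸n≡m _ (u n))) (cong (_∸ u n) (rec n))

balancing-scale : ∀ {u} d → BalancingRecurrence u → BalancingRecurrence (λ n → d * u n)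
balancing-scale {u} d rec n = begin
  d * u (suc (suc n)) + d * u n  ≡⟨ *-distribˡ-+ d _ _ ⟨
  d * (u (suc (suc n)) + u n)    ≡⟨ cong (d *_) (rec n) ⟩
  d * (6 * u (suc n))            ≡⟨ x∙yz≈y∙xz d 6 _ ⟩
  6 * (d * u (suc n))            ∎
  where open ≡-Reasoning

balancing-unscale : ∀ {u} d .{{_ : NonZero d}} →
                    BalancingRecurrence (λ n → d * u n) → BalancingRecurrence u
balancing-unscale {u} d rec n = *-cancelˡ-≡ _ _ d (begin
  d * (u (suc (suc n)) + u n)    ≡⟨ *-distribˡ-+ d _ _ ⟩
  d * u (suc (suc n)) + d * u n  ≡⟨ rec n ⟩
  6 * (d * u (suc n))            ≡⟨ x∙yz≈y∙xz 6 d _ ⟩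
  d * (6 * u (suc n))            ∎)
  where open ≡-Reasoning

balancing-descent : ∀ {u c} → BalancingRecurrence u →
                    ∀ m → c ∣ u m → c ∣ u (suc m) → c ∣ u 0
balancing-descent rec zero c∣u₀ _ = c∣u₀
balancing-descent {u} {c} rec (suc m) c∣uₘ₊₁ c∣uₘ₊₂ = balancing-descent {u} rec m c∣uₘ c∣uₘ₊₁
  where
  c∣uₘ : c ∣ u m
  c∣uₘ = ∣m+n∣m⇒∣n (subst (c ∣_) (sym (rec m)) (∣n⇒∣m*n 6 c∣uₘ₊₁)) c∣uₘ₊₂

isGCDOf-multiples : ∀ {u} → BalancingRecurrence u → u 0 ≡ 1 →
                    ∀ {f} d a → (∀ n → f n ≡ d * u (n + a)) → IsGCDOf f d
isGCDOf-multiples {u} rec u₀≡1 {f} d a f≡ =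
  (λ n → subst (d ∣_) (sym (f≡ n)) (m∣m*n _)) , greatest
  where
  greatest : ∀ c → (∀ n → c ∣ f n) → c ∣ d
  greatest c c∣f =
    subst (c ∣_) (trans (cong (d *_) u₀≡1) (*-identityʳ d))
      (balancing-descent {λ n → d * u n} (balancing-scale {u} d rec) a
        (subst (c ∣_) (f≡ 0) (c∣f 0)) (subst (c ∣_) (f≡ 1) (c∣f 1)))

balancingRecurrence-P[*2] : BalancingRecurrence (λ j → P (j * 2))
balancingRecurrence-P[*2] = pell⇒balancing-evens {P} λ n → refl

balancingRecurrence-Q[suc[*2]] : BalancingRecurrence (λ j → Q (suc (j * 2)))
balancingRecurrence-Q[suc[*2]] = pell⇒balancing-evens {λ n → Q (suc n)} λ n → refl

2*B≡P[*2] : ∀ j → 2 * B j ≡ P (j * 2)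
2*B≡P[*2] zero = refl
2*B≡P[*2] (suc zero) = refl
2*B≡P[*2] (suc (suc j)) = begin
  2 * (6 * B (suc j) ∸ B j)          ≡⟨ *-distribˡ-∸ 2 (6 * B (suc j)) (B j) ⟩
  2 * (6 * B (suc j)) ∸ 2 * B j      ≡⟨ cong₂ _∸_ (x∙yz≈y∙xz 2 6 (B (suc j))) (2*B≡P[*2] j) ⟩
  6 * (2 * B (suc j)) ∸ P (j * 2)    ≡⟨ cong (λ x → 6 * x ∸ P (j * 2)) (2*B≡P[*2] (suc j)) ⟩
  6 * P (suc j * 2) ∸ P (j * 2)      ≡⟨ balancing-∸ {λ j → P (j * 2)} balancingRecurrence-P[*2] j ⟨
  P (suc (suc j) * 2)                ∎
  where open ≡-Reasoning

balancingRecurrence-B : BalancingRecurrence B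
balancingRecurrence-B = balancing-unscale {B} 2 λ n → begin
  2 * B (suc (suc n)) + 2 * B n  ≡⟨ cong₂ _+_ (2*B≡P[*2] (suc (suc n))) (2*B≡P[*2] n) ⟩
  P (suc (suc n) * 2) + P (n * 2)  ≡⟨ balancingRecurrence-P[*2] n ⟩
  6 * P (suc n * 2)              ≡⟨ cong (6 *_) (2*B≡P[*2] (suc n)) ⟨
  6 * (2 * B (suc n))            ∎
  where open ≡-Reasoning

P[*2]/2≡B : ∀ j → P (j * 2) / 2 ≡ B j
P[*2]/2≡B j = trans (cong (_/ 2) (trans (sym (2*B≡P[*2] j)) (*-comm 2 (B j)))) (m*n/n≡m (B j) 2)

pell-suc : ∀ n → P (suc n) ≡ P n + Q n × Q (suc n) ≡ Q n + 2 * P n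
pell-suc zero = refl , refl
pell-suc (suc n) with pell-suc n
... | p≡ , q≡ rewrite p≡ | q≡ = identityP (P n) (Q n) , identityQ (P n) (Q n)
  where
  identityP : ∀ p q → 2 * (p + q) + p ≡ p + q + (q + 2 * p)
  identityP = solve-∀
  identityQ : ∀ p q → 2 * (q + 2 * p) + q ≡ q + 2 * p + 2 * (p + q)
  identityQ = solve-∀

pell-+ : ∀ m n → P (m + n) ≡ P m * Q n + Q m * P n × Q (m + n) ≡ Q m * Q n + 2 * (P m * P n)
pell-+ m zero rewrite +-identityʳ m = identityP (P m) (Q m) , identityQ (P m) (Q m)
  where
  identityP : ∀ p q → p ≡ p * 1 + q * 0
  identityP = solve-∀
  identityQ : ∀ p q → q ≡ q * 1 + 2 * (p * 0)
  identityQ = solve-∀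
pell-+ m (suc n) = P-part , Q-part
  where
  open ≡-Reasoning
  x y p q : ℕ
  x = P m ; y = Q m ; p = P n ; q = Q n
  P-part : P (m + suc n) ≡ x * Q (suc n) + y * P (suc n)
  P-part = begin
    P (m + suc n)                            ≡⟨ cong P (+-suc m n) ⟩
    P (suc (m + n))                          ≡⟨ proj₁ (pell-suc (m + n)) ⟩
    P (m + n) + Q (m + n)                    ≡⟨ cong₂ _+_ (proj₁ (pell-+ m n)) (proj₂ (pell-+ m n)) ⟩
    x * q + y * p + (y * q + 2 * (x * p))    ≡⟨ identityP x y p q ⟩
    x * (q + 2 * p) + y * (p + q)            ≡⟨ cong₂ (λ a b → x * a + y * b) (proj₂ (pell-suc n)) (proj₁ (pell-suc n)) ⟨
    x * Q (suc n) + y * P (suc n)            ∎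
    where
    identityP : ∀ x y p q → x * q + y * p + (y * q + 2 * (x * p)) ≡ x * (q + 2 * p) + y * (p + q)
    identityP = solve-∀
  Q-part : Q (m + suc n) ≡ y * Q (suc n) + 2 * (x * P (suc n))
  Q-part = begin
    Q (m + suc n)                                  ≡⟨ cong Q (+-suc m n) ⟩
    Q (suc (m + n))                                ≡⟨ proj₂ (pell-suc (m + n)) ⟩
    Q (m + n) + 2 * P (m + n)                      ≡⟨ cong₂ (λ a b → a + 2 * b) (proj₂ (pell-+ m n)) (proj₁ (pell-+ m n)) ⟩
    y * q + 2 * (x * p) + 2 * (x * q + y * p)      ≡⟨ identityQ x y p q ⟩
    y * (q + 2 * p) + 2 * (x * (p + q))            ≡⟨ cong₂ (λ a b → y * a + 2 * (x * b)) (proj₂ (pell-suc n)) (proj₁ (pell-suc n)) ⟨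
    y * Q (suc n) + 2 * (x * P (suc n))            ∎
    where
    identityQ : ∀ x y p q → y * q + 2 * (x * p) + 2 * (x * q + y * p) ≡ y * (q + 2 * p) + 2 * (x * (p + q))
    identityQ = solve-∀

pell-norm-step : ∀ n → Q (suc n) * Q (suc n) + Q n * Q n ≡ 2 * (P (suc n) * P (suc n)) + 2 * (P n * P n)
pell-norm-step n with pell-suc n
... | p≡ , q≡ rewrite p≡ | q≡ = identity (P n) (Q n)
  where
  identity : ∀ p q → (q + 2 * p) * (q + 2 * p) + q * q ≡ 2 * ((p + q) * (p + q)) + 2 * (p * p)
  identity = solve-∀

m+n≡o+[n+1]⇒m≡o+1 : ∀ m n o → m + n ≡ o + (n + 1) → m ≡ o + 1
m+n≡o+[n+1]⇒m≡o+1 m n o eq = +-cancelʳ-≡ n m (o + 1) (trans eq (reorder o n))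
  where
  reorder : ∀ o n → o + (n + 1) ≡ o + 1 + n
  reorder = solve-∀

pell-norm : ∀ j → Q (j * 2) * Q (j * 2) ≡ 2 * (P (j * 2) * P (j * 2)) + 1
                × Q (suc (j * 2)) * Q (suc (j * 2)) + 1 ≡ 2 * (P (suc (j * 2)) * P (suc (j * 2)))
pell-norm zero = refl , refl
pell-norm (suc j) = even , odd
  where
  n : ℕ
  n = suc (j * 2)
  even : Q (suc n) * Q (suc n) ≡ 2 * (P (suc n) * P (suc n)) + 1
  even = m+n≡o+[n+1]⇒m≡o+1 _ _ _
    (trans (pell-norm-step n) (cong (2 * (P (suc n) * P (suc n)) +_) (sym (proj₂ (pell-norm j)))))
  odd : Q (suc (suc n)) * Q (suc (suc n)) + 1 ≡ 2 * (P (suc (suc n)) * P (suc (suc n)))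
  odd = sym (m+n≡o+[n+1]⇒m≡o+1 _ _ _
    (trans (sym (pell-norm-step (suc n))) (cong (Q (suc (suc n)) * Q (suc (suc n)) +_) even)))

P-shift-odd : ∀ d k → Q k * Q k + 1 ≡ 2 * (P k * P k) → P (d + k + k) ≡ P d + 2 * (Q k * P (d + k))
P-shift-odd d k norm = begin
  P (d + k + k)                                      ≡⟨ proj₁ (pell-+ (d + k) k) ⟩
  P (d + k) * q + Q (d + k) * p                      ≡⟨ cong₂ (λ a b → a * q + b * p) P[d+k] Q[d+k] ⟩
  (x * q + y * p) * q + (y * q + 2 * (x * p)) * p    ≡⟨ expand x y p q ⟩
  x * (q * q) + 2 * (y * p * q) + x * (2 * (p * p))  ≡⟨ cong (λ z → x * (q * q) + 2 * (y * p * q) + x * z) norm ⟨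
  x * (q * q) + 2 * (y * p * q) + x * (q * q + 1)    ≡⟨ collect x y p q ⟩
  x + 2 * (q * (x * q + y * p))                      ≡⟨ cong (λ z → x + 2 * (q * z)) P[d+k] ⟨
  P d + 2 * (Q k * P (d + k))                        ∎
  where
  open ≡-Reasoning
  x y p q : ℕ
  x = P d ; y = Q d ; p = P k ; q = Q k
  P[d+k] : P (d + k) ≡ x * q + y * p
  P[d+k] = proj₁ (pell-+ d k)
  Q[d+k] : Q (d + k) ≡ y * q + 2 * (x * p)
  Q[d+k] = proj₂ (pell-+ d k)
  expand : ∀ x y p q → (x * q + y * p) * q + (y * q + 2 * (x * p)) * p
                     ≡ x * (q * q) + 2 * (y * p * q) + x * (2 * (p * p))
  expand = solve-∀
  collect : ∀ x y p q → x * (q * q) + 2 * (y * p * q) + x * (q * q + 1) ≡ x + 2 * (q * (x * q + y * p))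
  collect = solve-∀

P-shift-even : ∀ d k → Q k * Q k ≡ 2 * (P k * P k) + 1 → P (d + k + k) ≡ P d + 2 * (P k * Q (d + k))
P-shift-even d k norm = begin
  P (d + k + k)                                          ≡⟨ proj₁ (pell-+ (d + k) k) ⟩
  P (d + k) * q + Q (d + k) * p                          ≡⟨ cong₂ (λ a b → a * q + b * p) P[d+k] Q[d+k] ⟩
  (x * q + y * p) * q + (y * q + 2 * (x * p)) * p        ≡⟨ expand x y p q ⟩
  x * (q * q) + 2 * (y * p * q) + 2 * (x * (p * p))      ≡⟨ cong (λ z → x * z + 2 * (y * p * q) + 2 * (x * (p * p))) norm ⟩
  x * (2 * (p * p) + 1) + 2 * (y * p * q) + 2 * (x * (p * p))  ≡⟨ collect x y p q ⟩
  x + 2 * (p * (y * q + 2 * (x * p)))                    ≡⟨ cong (λ z → x + 2 * (p * z)) Q[d+k] ⟨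
  P d + 2 * (P k * Q (d + k))                            ∎
  where
  open ≡-Reasoning
  x y p q : ℕ
  x = P d ; y = Q d ; p = P k ; q = Q k
  P[d+k] : P (d + k) ≡ x * q + y * p
  P[d+k] = proj₁ (pell-+ d k)
  Q[d+k] : Q (d + k) ≡ y * q + 2 * (x * p)
  Q[d+k] = proj₂ (pell-+ d k)
  expand : ∀ x y p q → (x * q + y * p) * q + (y * q + 2 * (x * p)) * p
                     ≡ x * (q * q) + 2 * (y * p * q) + 2 * (x * (p * p))
  expand = solve-∀
  collect : ∀ x y p q → x * (2 * (p * p) + 1) + 2 * (y * p * q) + 2 * (x * (p * p))
                      ≡ x + 2 * (p * (y * q + 2 * (x * p)))
  collect = solve-∀

4*sumB+P≡P : ∀ k n → 4 * sumB k n + P (suc (n * 2)) ≡ P (suc ((n + k) * 2))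
4*sumB+P≡P zero n = cong (λ m → P (suc (m * 2))) (sym (+-identityʳ n))
4*sumB+P≡P (suc k) n = begin
  4 * (sumB k n + B (n + suc k)) + P (suc (n * 2))           ≡⟨ regroup (sumB k n) (B (n + suc k)) _ ⟩
  (4 * sumB k n + P (suc (n * 2))) + 2 * (2 * B (n + suc k)) ≡⟨ cong₂ (λ a b → a + 2 * b) (4*sumB+P≡P k n) (2*B≡P[*2] (n + suc k)) ⟩
  P (suc m) + 2 * P ((n + suc k) * 2)                       ≡⟨ cong (λ i → P (suc m) + 2 * P i) (index n k) ⟩
  P (suc m) + 2 * P (suc (suc m))                           ≡⟨ +-comm (P (suc m)) _ ⟩
  P (suc (suc (suc m)))                                     ≡⟨ cong (λ i → P (suc i)) (index n k) ⟨
  P (suc ((n + suc k) * 2))                                 ∎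
  where
  open ≡-Reasoning
  m : ℕ
  m = (n + k) * 2
  regroup : ∀ s b p → 4 * (s + b) + p ≡ (4 * s + p) + 2 * (2 * b)
  regroup = solve-∀
  index : ∀ n k → (n + suc k) * 2 ≡ suc (suc ((n + k) * 2))
  index = solve-∀

sumB-even : ∀ j n → sumB (j * 2) n ≡ B j * Q (suc ((n + j) * 2))
sumB-even j n = *-cancelˡ-≡ _ _ 4 (+-cancelʳ-≡ (P d) _ _ (begin
  4 * sumB k n + P d                       ≡⟨ 4*sumB+P≡P k n ⟩
  P (suc ((n + k) * 2))                    ≡⟨ cong P (index₁ n j) ⟩
  P (d + k + k)                            ≡⟨ P-shift-even d k (proj₁ (pell-norm j)) ⟩
  P d + 2 * (P k * Q (d + k))              ≡⟨ cong₂ (λ a i → P d + 2 * (a * Q i)) (2*B≡P[*2] j) (index₂ n j) ⟨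
  P d + 2 * (2 * B j * Q (suc ((n + j) * 2)))  ≡⟨ regroup (P d) (B j) _ ⟩
  4 * (B j * Q (suc ((n + j) * 2))) + P d  ∎))
  where
  open ≡-Reasoning
  k d : ℕ
  k = j * 2
  d = suc (n * 2)
  index₁ : ∀ n j → suc ((n + j * 2) * 2) ≡ suc (n * 2) + j * 2 + j * 2
  index₁ = solve-∀
  index₂ : ∀ n j → suc ((n + j) * 2) ≡ suc (n * 2) + j * 2
  index₂ = solve-∀
  regroup : ∀ a b q → a + 2 * (2 * b * q) ≡ 4 * (b * q) + a
  regroup = solve-∀

sumB-odd : ∀ j n → sumB (suc (j * 2)) n ≡ Q (suc (j * 2)) * B (suc (n + j))
sumB-odd j n = *-cancelˡ-≡ _ _ 4 (+-cancelʳ-≡ (P d) _ _ (begin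
  4 * sumB k n + P d                       ≡⟨ 4*sumB+P≡P k n ⟩
  P (suc ((n + k) * 2))                    ≡⟨ cong P (index₁ n j) ⟩
  P (d + k + k)                            ≡⟨ P-shift-odd d k (proj₂ (pell-norm j)) ⟩
  P d + 2 * (Q k * P (d + k))              ≡⟨ cong (λ i → P d + 2 * (Q k * P i)) (index₂ n j) ⟩
  P d + 2 * (Q k * P (suc (n + j) * 2))    ≡⟨ cong (λ b → P d + 2 * (Q k * b)) (2*B≡P[*2] (suc (n + j))) ⟨
  P d + 2 * (Q k * (2 * B (suc (n + j))))  ≡⟨ regroup (P d) (Q k) _ ⟩
  4 * (Q k * B (suc (n + j))) + P d        ∎))
  where
  open ≡-Reasoning
  k d : ℕ
  k = suc (j * 2)
  d = suc (n * 2)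
  index₁ : ∀ n j → suc ((n + suc (j * 2)) * 2) ≡ suc (n * 2) + suc (j * 2) + suc (j * 2)
  index₁ = solve-∀
  index₂ : ∀ n j → suc (n * 2) + suc (j * 2) ≡ suc (n + j) * 2
  index₂ = solve-∀
  regroup : ∀ a q b → a + 2 * (q * (2 * b)) ≡ 4 * (q * b) + a
  regroup = solve-∀

¬2∣⇒≡suc[*2] : ∀ k → ¬ (2 ∣ k) → ∃[ j ] k ≡ suc (j * 2)
¬2∣⇒≡suc[*2] zero 2∤0 = ⊥-elim (2∤0 (2 ∣0))
¬2∣⇒≡suc[*2] (suc zero) _ = 0 , refl
¬2∣⇒≡suc[*2] (suc (suc k)) 2∤k+2 with ¬2∣⇒≡suc[*2] k (λ 2∣k → 2∤k+2 (∣m∣n⇒∣m+n ∣-refl 2∣k))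
... | j , refl = suc j , refl

theorem17 : (k : ℕ) → 1 ≤ k →
    (2 ∣ k → IsGCDOf (λ n → sumB k n) (P k / 2)) ×
    (¬ (2 ∣ k) → IsGCDOf (λ n → sumB k n) (Q k))
theorem17 k _ = even , odd
  where
  even : 2 ∣ k → IsGCDOf (sumB k) (P k / 2)
  even (divides j refl) =
    subst (IsGCDOf (sumB (j * 2))) (sym (P[*2]/2≡B j))
      (isGCDOf-multiples {λ m → Q (suc (m * 2))} balancingRecurrence-Q[suc[*2]] refl (B j) j (sumB-even j))
  odd : ¬ (2 ∣ k) → IsGCDOf (sumB k) (Q k)
  odd 2∤k with ¬2∣⇒≡suc[*2] k 2∤k
  ... | j , refl =
    isGCDOf-multiples {λ m → B (suc m)} (λ m → balancingRecurrence-B (suc m)) refl (Q k) j (sumB-odd j)
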